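{- Let $G$ be a Hamiltonian graph with $|V(G)|=n$, $|E(G)|=m$, and maximum degree $\Delta(G)\geq 3$. If $\mathfrak{pr}(G)\leq m-1$, then $G$ is total prime.
   Context: All graphs are finite and simple. A coprime labeling of a graph $G$ of order $n$ is an injective map from $V(G)$ to $\{1,2,\ldots,k\}$ for some integer $k\geq n$ such that labels of adjacent vertices are relatively prime. The minimum coprime number $\mathfrak{pr}(G)$ is the smallest $k$ for which such a labeling exists. For a graph $G$ with vertex set $V$ and edge set $E$, a total prime labeling is a bijection $\ell: V\cup E\to\{1,2,\ldots,|V|+|E|\}$ such that (i) for every pair of adjacent vertices $u,v$, $\gcd(\ell(u),\ell(v))=1$, and (ii) for every vertex $v$ of degree at least 2, the greatest common divisor of the labels $\ell(uv)$ over all edges $uv$ incident to $v$ equals 1. A graph is total prime if it admits a total prime labeling. -}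

module Defs where

open import Data.Nat using (ℕ; zero; suc; _+_; _∸_; _≤_; _<_)
open import Data.Nat.Coprimality using (Coprime)
open import Data.Nat.GCD using (gcd)
open import Data.Fin using (Fin; toℕ)
open import Data.Fin.Properties using (_≟_)
open import Data.Product using (_×_; _,_; proj₁; proj₂; ∃; ∃-syntax)
open import Data.Sum using (_⊎_; inj₁; inj₂)
open import Data.List using (List; length; lookup; allFin; filter; map; foldr)
open import Data.List.Relation.Unary.All using (All)
open import Data.List.Relation.Unary.Unique.Propositional using (Unique)
open import Data.List.Membership.Propositional using (_∈_)
open import Data.Sum.Properties using ()
open import Relation.Binary.PropositionalEquality using (_≡_)
open import Relation.Nullary using (Dec; yes; no)
import Relation.Nullary.Decidable as Dec
open import Function.Definitions using (Injective)
open import Function.Bundles using (_⤖_; Bijection)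

-- A finite simple graph on vertex set Fin n: an edge list of pairs (u , v)
-- with toℕ u < toℕ v (no loops, canonical orientation) without repetitions
-- (no multiple edges).
record Graph : Set where
  field
    n       : ℕ
    edges   : List (Fin n × Fin n)
    ordered : All (λ e → toℕ (proj₁ e) < toℕ (proj₂ e)) edges
    unique  : Unique edges

module _ (G : Graph) where
  open Graph G

  order : ℕ
  order = n

  size : ℕ
  size = length edges

  Vertex : Set
  Vertex = Fin n

  Edge : Set
  Edge = Fin size

  ends : Edge → Fin n × Fin n
  ends e = lookup edges e

  Adj : Vertex → Vertex → Set
  Adj u v = (u , v) ∈ edges ⊎ (v , u) ∈ edges

  Incident : Vertex → Edge → Set
  Incident v e = proj₁ (ends e) ≡ v ⊎ proj₂ (ends e) ≡ v

  incident? : (v : Vertex) → (e : Edge) → Dec (Incident v e)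
  incident? v e = Dec._⊎-dec_ (proj₁ (ends e) ≟ v) (proj₂ (ends e) ≟ v)

  incidentEdges : Vertex → List Edge
  incidentEdges v = filter (incident? v) (allFin size)

  degree : Vertex → ℕ
  degree v = length (incidentEdges v)

  MaxDegreeAtLeast : ℕ → Set
  MaxDegreeAtLeast d = ∃[ v ] d ≤ degree v

  -- Hamiltonian: a cyclic ordering c 0, c 1, …, c (n-1) of all vertices
  -- (injective, hence a bijection of Fin n) forming a cycle, with n ≥ 3.
  Hamiltonian : Set
  Hamiltonian =
    3 ≤ n × ∃[ c ] (Injective _≡_ _≡_ c
      × (∀ (i j : Fin n) → suc (toℕ i) ≡ toℕ j → Adj (c i) (c j))
      × (∀ (i j : Fin n) → toℕ i ≡ 0 → suc (toℕ j) ≡ n → Adj (c j) (c i)))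

  CoprimeLabeling : ℕ → Set
  CoprimeLabeling k =
    n ≤ k × ∃[ f ] (Injective _≡_ _≡_ f
      × (∀ v → 1 ≤ f v × f v ≤ k)
      × (∀ u v → Adj u v → Coprime (f u) (f v)))

  -- pr(G) ≤ k  (pr is the least k admitting a coprime labeling)
  MinCoprimeNumberAtMost : ℕ → Set
  MinCoprimeNumberAtMost k = ∃[ k' ] (k' ≤ k × CoprimeLabeling k')

  -- total prime labeling: bijection between V ⊎ E and Fin (n + m);
  -- the label of x is 1 + toℕ (bijection x), i.e. labels are {1,…,n+m}.
  record TotalPrimeLabeling : Set where
    field
      bij : (Vertex ⊎ Edge) ⤖ Fin (n + size)
    label : Vertex ⊎ Edge → ℕ
    label x = suc (toℕ (Bijection.to bij x))
    field
      vertexCond : ∀ u v → Adj u v → Coprime (label (inj₁ u)) (label (inj₁ v))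
      edgeCond   : ∀ v → 2 ≤ degree v →
                   foldr gcd 0 (map (λ e → label (inj₂ e)) (incidentEdges v)) ≡ 1

  TotalPrime : Set
  TotalPrime = TotalPrimeLabeling

-- Rotate the Hamiltonian cycle v₀ v₁ … vₙ₋₁ so that v₀ has degree at least 3, and pick an edge
-- e₀ at v₀ that is not on the cycle. Keep the coprime vertex labels (all below m), label e₀ by m
-- and the cycle edge vₖvₖ₊₁ by m + 1 + k, and spread the unused labels over the remaining edges.
-- Every vertex vₖ then lies on two edges with the consecutive labels m + k and m + k + 1, so the
-- gcd of the labels at vₖ is 1.

module Submission where

open import Defs
open import Data.Nat using (_∸_)

open import Data.Nat using (ℕ; zero; suc; pred; _+_; _*_; _≤_; _<_; _%_; NonZero; >-nonZero; z≤n; s≤s; _<?_)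
open import Data.Nat.Properties hiding (_≟_)
open import Data.Nat.DivMod using (_mod_; %-distribˡ-+; [m+kn]%n≡m%n; m%n%n≡m%n; m<n⇒m%n≡m; m%n<n; n%n≡0)
open import Data.Nat.Divisibility using (_∣_; ∣-trans; ∣1⇒≡1; ∣m+n∣m⇒∣n)
open import Data.Nat.GCD using (gcd; gcd[m,n]∣m; gcd[m,n]∣n)
open import Data.Nat.Coprimality using (Coprime)
open import Data.Nat.Tactic.RingSolver using (solve-∀)
open import Data.Fin using (Fin; toℕ; fromℕ<; punchOut) renaming (zero to fzero; suc to fsuc)
open import Data.Fin.Properties
  using (_≟_; toℕ-injective; toℕ-fromℕ<; toℕ<n; toℕ≤pred[n]; +↔⊎; punchOut-injective; injective⇒≤; any?)
  renaming (suc-injective to fsuc-injective; 0≢1+n to fzero≢fsuc)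
import Data.Fin.Permutation.Components as PC
open import Data.Fin.Permutation using (transpose)
open import Data.List using (List; []; _∷_; foldr; map; length; allFin)
open import Data.List.Relation.Unary.Any using (here; there; index)
open import Data.List.Relation.Unary.Any.Properties using (lookup-index)
open import Data.List.Relation.Unary.All using (_∷_)
open import Data.List.Relation.Unary.AllPairs using (_∷_)
open import Data.List.Relation.Unary.Unique.Propositional using (Unique)
import Data.List.Relation.Unary.Unique.Propositional.Properties as Unique
open import Data.List.Membership.Propositional using (_∈_)
open import Data.List.Membership.Propositional.Properties using (∈-map⁺; ∈-filter⁺; ∈-filter⁻; ∈-allFin)
open import Data.Product using (_×_; _,_; proj₁; proj₂; swap; ∃-syntax; Σ-syntax)
open import Data.Product.Properties using (,-injective)
open import Data.Sum using (_⊎_; inj₁; inj₂; [_,_]′)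
open import Data.Sum.Properties using (inj₂-injective)
open import Function using (_∘_)
open import Function.Bundles using (_⤖_; _↔_; Bijection; Inverse)
open import Function.Construct.Composition using (_⤖-∘_)
open import Function.Definitions using (Injective)
open import Function.Properties.Inverse using (↔⇒⤖)
open import Function.Construct.Symmetry using (↔-sym)
open import Relation.Binary.Definitions using (DecidableEquality)
open import Relation.Binary.PropositionalEquality
open import Relation.Nullary using (yes; no; contradiction)
open import Relation.Nullary.Decidable using (dec-true; dec-false)

m≤n∸1⇒m<n : ∀ {m n} → 1 ≤ m → m ≤ n ∸ 1 → m < n
m≤n∸1⇒m<n {n = zero}  1≤m m≤0 = contradiction (≤-trans 1≤m m≤0) λ ()
m≤n∸1⇒m<n {n = suc _} _   m≤n = s≤s m≤n

%-cong-+ˡ : ∀ k {a b n} .{{_ : NonZero n}} → a % n ≡ b % n → (k + a) % n ≡ (k + b) % n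
%-cong-+ˡ k {a} {b} {n} a≡b = begin
  (k + a) % n          ≡⟨ %-distribˡ-+ k a n ⟩
  (k % n + a % n) % n  ≡⟨ cong (λ x → (k % n + x) % n) a≡b ⟩
  (k % n + b % n) % n  ≡⟨ %-distribˡ-+ k b n ⟨
  (k + b) % n          ∎
  where open ≡-Reasoning

%-cancel-+ˡ : ∀ k {a b n} .{{_ : NonZero n}} → (k + a) % n ≡ (k + b) % n → a % n ≡ b % n
%-cancel-+ˡ k {a} {b} {n@(suc n-1)} k+a≡k+b = begin
  a % n                    ≡⟨ [m+kn]%n≡m%n a k n ⟨
  (a + k * n) % n          ≡⟨ cong (_% n) (regroup a k n-1) ⟩
  (k * n-1 + (k + a)) % n  ≡⟨ %-cong-+ˡ (k * n-1) k+a≡k+b ⟩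
  (k * n-1 + (k + b)) % n  ≡⟨ cong (_% n) (regroup b k n-1) ⟨
  (b + k * n) % n          ≡⟨ [m+kn]%n≡m%n b k n ⟩
  b % n                    ∎
  where
  open ≡-Reasoning
  regroup : ∀ x k m → x + k * suc m ≡ k * m + (k + x)
  regroup = solve-∀

%-cancel-+ʳ : ∀ k {a b n} .{{_ : NonZero n}} → (a + k) % n ≡ (b + k) % n → a % n ≡ b % n
%-cancel-+ʳ k {a} {b} {n} a+k≡b+k = %-cancel-+ˡ k (begin
  (k + a) % n  ≡⟨ cong (_% n) (+-comm k a) ⟩
  (a + k) % n  ≡⟨ a+k≡b+k ⟩
  (b + k) % n  ≡⟨ cong (_% n) (+-comm b k) ⟩
  (k + b) % n  ∎)
  where open ≡-Reasoning

[1+m]%n≡[1+m%n]%n : ∀ m n .{{_ : NonZero n}} → suc m % n ≡ suc (m % n) % n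
[1+m]%n≡[1+m%n]%n m n = %-cong-+ˡ 1 (sym (m%n%n≡m%n m n))

%-suc : ∀ m n .{{_ : NonZero n}} →
        suc (m % n) ≡ suc m % n ⊎ (suc m % n ≡ 0 × suc (m % n) ≡ n)
%-suc m n with suc (m % n) <? n
... | yes m%n+1<n = inj₁ (sym (trans ([1+m]%n≡[1+m%n]%n m n) (m<n⇒m%n≡m m%n+1<n)))
... | no  m%n+1≮n = inj₂ (wraps-to-0 , wraps)
  where
  wraps : suc (m % n) ≡ n
  wraps = ≤-antisym (m%n<n m n) (≮⇒≥ m%n+1≮n)
  wraps-to-0 : suc m % n ≡ 0
  wraps-to-0 = trans ([1+m]%n≡[1+m%n]%n m n) (trans (cong (_% n) wraps) (n%n≡0 n))

toℕ-mod : ∀ m n .{{_ : NonZero n}} → toℕ (m mod n) ≡ m % n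
toℕ-mod m n = toℕ-fromℕ< (m%n<n m n)

foldr-gcd-∣ : ∀ {x} xs → x ∈ xs → foldr gcd 0 xs ∣ x
foldr-gcd-∣ (y ∷ ys) (here refl) = gcd[m,n]∣m y (foldr gcd 0 ys)
foldr-gcd-∣ (y ∷ ys) (there x∈ys) = ∣-trans (gcd[m,n]∣n y (foldr gcd 0 ys)) (foldr-gcd-∣ ys x∈ys)

foldr-gcd-consecutive : ∀ {x} xs → x ∈ xs → suc x ∈ xs → foldr gcd 0 xs ≡ 1
foldr-gcd-consecutive {x} xs x∈xs 1+x∈xs =
  ∣1⇒≡1 (∣m+n∣m⇒∣n (subst (foldr gcd 0 xs ∣_) (+-comm 1 x) (foldr-gcd-∣ xs 1+x∈xs)) (foldr-gcd-∣ xs x∈xs))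

injective⇒surjective : ∀ {n} (f : Fin n → Fin n) → Injective _≡_ _≡_ f → ∀ y → ∃[ x ] f x ≡ y
injective⇒surjective {suc n} f f-injective y with any? (λ x → f x ≟ y)
... | yes hit = hit
... | no  miss = contradiction (injective⇒≤ punched-injective) (<-irrefl refl)
  where
  y≢f : ∀ x → y ≢ f x
  y≢f x y≡fx = miss (x , sym y≡fx)
  punched-injective : Injective _≡_ _≡_ (λ x → punchOut (y≢f x))
  punched-injective {x} {x′} = f-injective ∘ punchOut-injective (y≢f x) (y≢f x′)

transpose-matchˡ : ∀ {N} (i j : Fin N) → PC.transpose i j i ≡ j
transpose-matchˡ i j rewrite dec-true (i ≟ i) refl = refl

transpose-mismatch : ∀ {N} {i j k : Fin N} → k ≢ i → k ≢ j → PC.transpose i j k ≡ k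
transpose-mismatch {i = i} {j} {k} k≢i k≢j
  rewrite dec-false (k ≟ i) k≢i | dec-false (k ≟ j) k≢j = refl

extend-bijection : ∀ {A : Set} {N} K (a : Fin K → A) (y : Fin K → Fin N) →
                   Injective _≡_ _≡_ a → Injective _≡_ _≡_ y → A ⤖ Fin N →
                   Σ[ σ ∈ A ⤖ Fin N ] (∀ k → Bijection.to σ (a k) ≡ y k)
extend-bijection zero    a y _ _ σ₀ = σ₀ , λ ()
extend-bijection (suc K) a y a-injective y-injective σ₀
  with σ , σ-agrees ← extend-bijection K (a ∘ fsuc) (y ∘ fsuc)
                        (fsuc-injective ∘ a-injective) (fsuc-injective ∘ y-injective) σ₀
  = ↔⇒⤖ (transpose (to σ (a fzero)) (y fzero)) ⤖-∘ σ , agrees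
  where
  open Bijection using (to)
  agrees : ∀ k → PC.transpose (to σ (a fzero)) (y fzero) (to σ (a k)) ≡ y k
  agrees fzero    = transpose-matchˡ (to σ (a fzero)) (y fzero)
  agrees (fsuc k) rewrite σ-agrees k = transpose-mismatch
    (λ yk≡σa0 → fzero≢fsuc (sym (a-injective (Bijection.injective σ (trans (σ-agrees k) yk≡σa0)))))
    (λ yk≡y0 → fzero≢fsuc (sym (y-injective yk≡y0)))

extend-bijection-along : ∀ {A I : Set} {N K} → Fin K ↔ I → (a : I → A) (y : I → Fin N) →
                         Injective _≡_ _≡_ a → Injective _≡_ _≡_ y → A ⤖ Fin N →
                         Σ[ σ ∈ A ⤖ Fin N ] (∀ i → Bijection.to σ (a i) ≡ y i)
extend-bijection-along {K = K} ι a y a-injective y-injective σ₀ =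
  let σ , σ-agrees = extend-bijection K (a ∘ to) (y ∘ to) (ι-injective ∘ a-injective) (ι-injective ∘ y-injective) σ₀
  in  σ , λ i → subst (λ j → Bijection.to σ (a j) ≡ y j) (strictlyInverseˡ i) (σ-agrees (from i))
  where
  open Inverse ι using (to; from; strictlyInverseˡ)
  ι-injective : Injective _≡_ _≡_ to
  ι-injective = Bijection.injective (↔⇒⤖ ι)

one-avoids : ∀ {A : Set} → DecidableEquality A → ∀ {x y : A} → x ≢ y → ∀ b → x ≢ b ⊎ y ≢ b
one-avoids _≟_ {x} x≢y b with x ≟ b
... | yes refl = inj₂ (x≢y ∘ sym)
... | no  x≢b  = inj₁ x≢b

∃-avoiding-two : ∀ {A : Set} → DecidableEquality A → ∀ {xs : List A} → Unique xs → 3 ≤ length xs →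
                 ∀ a b → ∃[ x ] x ∈ xs × x ≢ a × x ≢ b
∃-avoiding-two _≟_ {x₁ ∷ x₂ ∷ x₃ ∷ _} ((x₁≢x₂ ∷ x₁≢x₃ ∷ _) ∷ (x₂≢x₃ ∷ _) ∷ _) _ a b
  with x₁ ≟ a | x₁ ≟ b
... | no x₁≢a | no x₁≢b = x₁ , here refl , x₁≢a , x₁≢b
... | yes refl | _ = [ (λ x₂≢b → x₂ , there (here refl) , x₁≢x₂ ∘ sym , x₂≢b)
                     , (λ x₃≢b → x₃ , there (there (here refl)) , x₁≢x₃ ∘ sym , x₃≢b)
                     ]′ (one-avoids _≟_ x₂≢x₃ b)
... | no _ | yes refl = [ (λ x₂≢a → x₂ , there (here refl) , x₂≢a , x₁≢x₂ ∘ sym)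
                        , (λ x₃≢a → x₃ , there (there (here refl)) , x₃≢a , x₁≢x₃ ∘ sym)
                        ]′ (one-avoids _≟_ x₂≢x₃ a)
∃-avoiding-two _ {[]}             _ ()                   _ _
∃-avoiding-two _ {_ ∷ []}         _ (s≤s ())             _ _
∃-avoiding-two _ {_ ∷ _ ∷ []}     _ (s≤s (s≤s ()))       _ _

module _ (G : Graph) where
  Joins : Edge G → Vertex G → Vertex G → Set
  Joins e u v = ends G e ≡ (u , v) ⊎ ends G e ≡ (v , u)

  edgeOf : ∀ {u v} → Adj G u v → Edge G
  edgeOf (inj₁ uv∈edges) = index uv∈edges
  edgeOf (inj₂ vu∈edges) = index vu∈edges

  edgeOf-joins : ∀ {u v} (u~v : Adj G u v) → Joins (edgeOf u~v) u v
  edgeOf-joins (inj₁ uv∈edges) = inj₁ (sym (lookup-index uv∈edges))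
  edgeOf-joins (inj₂ vu∈edges) = inj₂ (sym (lookup-index vu∈edges))

  joins-incidentˡ : ∀ {e u v} → Joins e u v → Incident G u e
  joins-incidentˡ (inj₁ refl) = inj₁ refl
  joins-incidentˡ (inj₂ refl) = inj₂ refl

  joins-incidentʳ : ∀ {e u v} → Joins e u v → Incident G v e
  joins-incidentʳ (inj₁ refl) = inj₂ refl
  joins-incidentʳ (inj₂ refl) = inj₁ refl

  incident-joins : ∀ {e u v x} → Joins e u v → Incident G x e → x ≡ u ⊎ x ≡ v
  incident-joins (inj₁ refl) (inj₁ refl) = inj₁ refl
  incident-joins (inj₁ refl) (inj₂ refl) = inj₂ refl
  incident-joins (inj₂ refl) (inj₁ refl) = inj₂ refl
  incident-joins (inj₂ refl) (inj₂ refl) = inj₁ refl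

  joins-unique : ∀ {e u v u′ v′} → Joins e u v → Joins e u′ v′ →
                 (u ≡ u′ × v ≡ v′) ⊎ (u ≡ v′ × v ≡ u′)
  joins-unique (inj₁ p) (inj₁ q) = inj₁ (,-injective (trans (sym p) q))
  joins-unique (inj₁ p) (inj₂ q) = inj₂ (,-injective (trans (sym p) q))
  joins-unique (inj₂ p) (inj₁ q) = inj₂ (swap (,-injective (trans (sym p) q)))
  joins-unique (inj₂ p) (inj₂ q) = inj₁ (swap (,-injective (trans (sym p) q)))

  ∈-incidentEdges : ∀ {v e} → Incident G v e → e ∈ incidentEdges G v
  ∈-incidentEdges {v} {e} = ∈-filter⁺ (incident? G v) (∈-allFin e)

  incidentEdges-unique : ∀ v → Unique (incidentEdges G v)
  incidentEdges-unique v = Unique.filter⁺ (incident? G v) (Unique.allFin⁺ (size G))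

record ConsecutiveEdgeCover (G : Graph) : Set where
  field
    vertexAt            : ℕ → Vertex G
    edgeAt              : ℕ → Edge G
    vertexAt-surjective : ∀ v → ∃[ k ] k < order G × vertexAt k ≡ v
    edgeAt-injective    : ∀ {k l} → k ≤ order G → l ≤ order G → edgeAt k ≡ edgeAt l → k ≡ l
    edgeAt-incident     : ∀ k → Incident G (vertexAt k) (edgeAt k)
    edgeAt-incident-suc : ∀ k → Incident G (vertexAt k) (edgeAt (suc k))

module CoverLabelling (G : Graph) (cover : ConsecutiveEdgeCover G) {f : Vertex G → ℕ}
                      (f-injective : Injective _≡_ _≡_ f) (f-positive : ∀ v → 1 ≤ f v)
                      (f<size : ∀ v → f v < size G) where
  open ConsecutiveEdgeCover cover
  open Bijection using (to)

  private
    n m : ℕ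
    n = order G
    m = size G

    instance
      m-nonZero : NonZero m
      m-nonZero = >-nonZero (≤-<-trans z≤n (toℕ<n (edgeAt 0)))

  Prescribed : Set
  Prescribed = Fin n ⊎ Fin (suc n)

  element : Prescribed → Vertex G ⊎ Edge G
  element (inj₁ v) = inj₁ v
  element (inj₂ k) = inj₂ (edgeAt (toℕ k))

  -- One less than the intended label, since a labelling assigns x the label 1 + toℕ (σ x).
  position : Prescribed → ℕ
  position (inj₁ v) = pred (f v)
  position (inj₂ k) = pred m + toℕ k

  element-injective : Injective _≡_ _≡_ element
  element-injective {inj₁ _} {inj₁ _} refl = refl
  element-injective {inj₂ k} {inj₂ l} eq =
    cong inj₂ (toℕ-injective (edgeAt-injective (toℕ≤pred[n] k) (toℕ≤pred[n] l) (inj₂-injective eq)))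

  vertex-position<edge-position : ∀ v k → pred (f v) < pred m + k
  vertex-position<edge-position v k =
    <-≤-trans (pred-mono-< {{>-nonZero (f-positive v)}} (f<size v)) (m≤m+n (pred m) k)

  position-injective : Injective _≡_ _≡_ position
  position-injective {inj₁ u} {inj₁ v} eq = cong inj₁ (f-injective (begin
    f u               ≡⟨ suc-pred (f u) {{>-nonZero (f-positive u)}} ⟨
    suc (pred (f u))  ≡⟨ cong suc eq ⟩
    suc (pred (f v))  ≡⟨ suc-pred (f v) {{>-nonZero (f-positive v)}} ⟩
    f v               ∎))
    where open ≡-Reasoning
  position-injective {inj₁ v} {inj₂ k} eq = contradiction eq (<⇒≢ (vertex-position<edge-position v (toℕ k)))
  position-injective {inj₂ k} {inj₁ v} eq = contradiction eq (>⇒≢ (vertex-position<edge-position v (toℕ k)))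
  position-injective {inj₂ k} {inj₂ l} eq = cong inj₂ (toℕ-injective (+-cancelˡ-≡ (pred m) _ _ eq))

  position<n+m : ∀ i → position i < n + m
  position<n+m (inj₁ v) = <-≤-trans (≤-<-trans pred[n]≤n (f<size v)) (m≤n+m m n)
  position<n+m (inj₂ k) = begin-strict
    pred m + toℕ k  ≤⟨ +-monoʳ-≤ (pred m) (toℕ≤pred[n] k) ⟩
    pred m + n      <⟨ +-monoˡ-< n (m≤pred[n]⇒suc[m]≤n ≤-refl) ⟩
    m + n           ≡⟨ +-comm m n ⟩
    n + m           ∎
    where open ≤-Reasoning

  private
    slot : Prescribed → Fin (n + m)
    slot i = fromℕ< (position<n+m i)

    slot-injective : Injective _≡_ _≡_ slot
    slot-injective {i} {j} eq = position-injective (begin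
      position i     ≡⟨ toℕ-fromℕ< (position<n+m i) ⟨
      toℕ (slot i)   ≡⟨ cong toℕ eq ⟩
      toℕ (slot j)   ≡⟨ toℕ-fromℕ< (position<n+m j) ⟩
      position j     ∎)
      where open ≡-Reasoning

  labelling : Σ[ σ ∈ (Vertex G ⊎ Edge G) ⤖ Fin (n + m) ] (∀ i → toℕ (to σ (element i)) ≡ position i)
  labelling with σ , agrees ← extend-bijection-along +↔⊎ element slot element-injective slot-injective
                                (↔⇒⤖ (↔-sym +↔⊎))
    = σ , λ i → trans (cong toℕ (agrees i)) (toℕ-fromℕ< (position<n+m i))

  totalPrime : (∀ u v → Adj G u v → Coprime (f u) (f v)) → TotalPrime G
  totalPrime f-coprime with σ , agrees ← labelling = record
    { bij        = σ
    ; vertexCond = λ u v u~v → subst₂ Coprime (sym (vertex-label u)) (sym (vertex-label v)) (f-coprime u v u~v)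
    ; edgeCond   = λ v _ → consecutive-labels-at v
    }
    where
    open ≡-Reasoning

    label : Vertex G ⊎ Edge G → ℕ
    label x = suc (toℕ (to σ x))

    vertex-label : ∀ v → label (inj₁ v) ≡ f v
    vertex-label v = trans (cong suc (agrees (inj₁ v))) (suc-pred (f v) {{>-nonZero (f-positive v)}})

    edge-label : ∀ {k} → k ≤ n → label (inj₂ (edgeAt k)) ≡ m + k
    edge-label {k} k≤n = begin
      label (inj₂ (edgeAt k))    ≡⟨ cong (label ∘ inj₂ ∘ edgeAt) toℕ-k′ ⟨
      label (element (inj₂ k′))  ≡⟨ cong suc (agrees (inj₂ k′)) ⟩
      suc (pred m + toℕ k′)      ≡⟨ cong (λ j → suc (pred m + j)) toℕ-k′ ⟩
      suc (pred m) + k           ≡⟨ cong (_+ k) (suc-pred m) ⟩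
      m + k                      ∎
      where
      k′ : Fin (suc n)
      k′ = fromℕ< (s≤s k≤n)
      toℕ-k′ : toℕ k′ ≡ k
      toℕ-k′ = toℕ-fromℕ< (s≤s k≤n)

    incidentLabels : Vertex G → List ℕ
    incidentLabels v = map (label ∘ inj₂) (incidentEdges G v)

    edge-label∈ : ∀ {v k} → k ≤ n → Incident G v (edgeAt k) → m + k ∈ incidentLabels v
    edge-label∈ {v} k≤n v∈e =
      subst (_∈ incidentLabels v) (edge-label k≤n) (∈-map⁺ (label ∘ inj₂) (∈-incidentEdges G v∈e))

    consecutive-labels-at : ∀ v → foldr gcd 0 (incidentLabels v) ≡ 1
    consecutive-labels-at v with k , k<n , refl ← vertexAt-surjective v =
      foldr-gcd-consecutive (incidentLabels v) (edge-label∈ (<⇒≤ k<n) (edgeAt-incident k))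
        (subst (_∈ incidentLabels v) (+-suc m k) (edge-label∈ k<n (edgeAt-incident-suc k)))

module HamiltonianWalk (G : Graph) {c : Fin (order G) → Vertex G} (3≤n : 3 ≤ order G)
  (c-injective : Injective _≡_ _≡_ c)
  (c-step      : ∀ i j → suc (toℕ i) ≡ toℕ j → Adj G (c i) (c j))
  (c-close     : ∀ i j → toℕ i ≡ 0 → suc (toℕ j) ≡ order G → Adj G (c j) (c i))
  (s : Fin (order G)) where
  open ≡-Reasoning

  private
    n : ℕ
    n = order G

    0<n : 0 < n
    0<n = ≤-trans (s≤s z≤n) 3≤n

    instance
      n-nonZero : NonZero n
      n-nonZero = >-nonZero 0<n

  cycle-adjacent : ∀ a → Adj G (c (a mod n)) (c (suc a mod n))
  cycle-adjacent a with %-suc a n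
  ... | inj₁ step = c-step (a mod n) (suc a mod n)
    (subst₂ (λ x y → suc x ≡ y) (sym (toℕ-mod a n)) (sym (toℕ-mod (suc a) n)) step)
  ... | inj₂ (wraps-to-0 , wraps) = c-close (suc a mod n) (a mod n)
    (trans (toℕ-mod (suc a) n) wraps-to-0) (trans (cong suc (toℕ-mod a n)) wraps)

  walk : ℕ → Vertex G
  walk k = c ((toℕ s + k) mod n)

  walk-adjacent : ∀ k → Adj G (walk k) (walk (suc k))
  walk-adjacent k =
    subst (λ x → Adj G (walk k) (c (x mod n))) (sym (+-suc (toℕ s) k)) (cycle-adjacent (toℕ s + k))

  walk-start : walk 0 ≡ c s
  walk-start = cong c (toℕ-injective (begin
    toℕ ((toℕ s + 0) mod n)  ≡⟨ toℕ-mod (toℕ s + 0) n ⟩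
    (toℕ s + 0) % n          ≡⟨ cong (_% n) (+-identityʳ (toℕ s)) ⟩
    toℕ s % n                ≡⟨ m<n⇒m%n≡m (toℕ<n s) ⟩
    toℕ s                    ∎))

  walk-≡⇒%-≡ : ∀ {k l} → walk k ≡ walk l → k % n ≡ l % n
  walk-≡⇒%-≡ {k} {l} walk-k≡walk-l = %-cancel-+ˡ (toℕ s) (begin
    (toℕ s + k) % n          ≡⟨ toℕ-mod (toℕ s + k) n ⟨
    toℕ ((toℕ s + k) mod n)  ≡⟨ cong toℕ (c-injective walk-k≡walk-l) ⟩
    toℕ ((toℕ s + l) mod n)  ≡⟨ toℕ-mod (toℕ s + l) n ⟩
    (toℕ s + l) % n          ∎)

  walk-injective : ∀ {k l} → k < n → l < n → walk k ≡ walk l → k ≡ l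
  walk-injective {k} {l} k<n l<n walk-k≡walk-l = begin
    k      ≡⟨ m<n⇒m%n≡m k<n ⟨
    k % n  ≡⟨ walk-≡⇒%-≡ walk-k≡walk-l ⟩
    l % n  ≡⟨ m<n⇒m%n≡m l<n ⟩
    l      ∎

  walk-surjective : ∀ v → ∃[ k ] k < n × walk k ≡ v
  walk-surjective v
    with i , refl ← injective⇒surjective (walk ∘ toℕ)
                      (λ {i} {j} → toℕ-injective ∘ walk-injective (toℕ<n i) (toℕ<n j)) v
    = toℕ i , toℕ<n i , refl

  -- Reversing would force 2 + l ≡ l (mod n), impossible for n ≥ 3.
  walk-never-reverses : ∀ k l → walk k ≡ walk (suc l) → walk (suc k) ≢ walk l
  walk-never-reverses k l k≈l+1 k+1≈l = contradiction 2≡0 λ ()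
    where
    2%n≡0%n : 2 % n ≡ 0 % n
    2%n≡0%n = %-cancel-+ʳ l {2} {0} (begin
      (2 + l) % n  ≡⟨ %-cong-+ˡ 1 {suc l} {k} (sym (walk-≡⇒%-≡ k≈l+1)) ⟩
      (1 + k) % n  ≡⟨ walk-≡⇒%-≡ k+1≈l ⟩
      (0 + l) % n  ∎)
    2≡0 : 2 ≡ 0
    2≡0 = trans (sym (m<n⇒m%n≡m 3≤n)) (trans 2%n≡0%n (m<n⇒m%n≡m 0<n))

  cycleEdge : ℕ → Edge G
  cycleEdge k = edgeOf G (walk-adjacent k)

  cycleEdge-joins : ∀ k → Joins G (cycleEdge k) (walk k) (walk (suc k))
  cycleEdge-joins k = edgeOf-joins G (walk-adjacent k)

  cycleEdge-injective : ∀ {k l} → k < n → l < n → cycleEdge k ≡ cycleEdge l → k ≡ l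
  cycleEdge-injective {k} {l} k<n l<n eq
    with joins-unique G (cycleEdge-joins k) (subst (λ e → Joins G e (walk l) (walk (suc l))) (sym eq) (cycleEdge-joins l))
  ... | inj₁ (k≈l , _)         = walk-injective k<n l<n k≈l
  ... | inj₂ (k≈l+1 , k+1≈l)  = contradiction k+1≈l (walk-never-reverses k l k≈l+1)

  cycleEdge-at-start : ∀ {k} → k < n → Incident G (walk 0) (cycleEdge k) → k ≡ 0 ⊎ suc k ≡ n
  cycleEdge-at-start {k} k<n start∈e with incident-joins G (cycleEdge-joins k) start∈e
  ... | inj₁ start≈k = inj₁ (sym (walk-injective 0<n k<n start≈k))
  ... | inj₂ start≈k+1 with m≤n⇒m<n∨m≡n k<n
  ...   | inj₁ k+1<n = contradiction (walk-injective 0<n k+1<n start≈k+1) λ ()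
  ...   | inj₂ k+1≡n = inj₂ k+1≡n

  consecutiveEdgeCover : 3 ≤ degree G (walk 0) → ConsecutiveEdgeCover G
  consecutiveEdgeCover 3≤degree
    with chord , chord∈ , chord≢first , chord≢last
           ← ∃-avoiding-two _≟_ (incidentEdges-unique G (walk 0)) 3≤degree (cycleEdge 0) (cycleEdge (pred n))
    = record
      { vertexAt            = walk
      ; edgeAt              = edgeAt
      ; vertexAt-surjective = walk-surjective
      ; edgeAt-injective    = edgeAt-injective
      ; edgeAt-incident     = edgeAt-incident
      ; edgeAt-incident-suc = λ k → joins-incidentˡ G (cycleEdge-joins k)
      }
    where
    chord-incident : Incident G (walk 0) chord
    chord-incident = proj₂ (∈-filter⁻ (incident? G (walk 0)) {xs = allFin (size G)} chord∈)

    chord-off-cycle : ∀ {k} → k < n → chord ≢ cycleEdge k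
    chord-off-cycle k<n chord≡e with cycleEdge-at-start k<n (subst (Incident G (walk 0)) chord≡e chord-incident)
    ... | inj₁ refl  = chord≢first chord≡e
    ... | inj₂ k+1≡n = chord≢last (trans chord≡e (cong (cycleEdge ∘ pred) k+1≡n))

    edgeAt : ℕ → Edge G
    edgeAt zero    = chord
    edgeAt (suc k) = cycleEdge k

    edgeAt-injective : ∀ {k l} → k ≤ n → l ≤ n → edgeAt k ≡ edgeAt l → k ≡ l
    edgeAt-injective {zero}  {zero}  _   _   _  = refl
    edgeAt-injective {zero}  {suc l} _   l<n eq = contradiction eq (chord-off-cycle l<n)
    edgeAt-injective {suc k} {zero}  k<n _   eq = contradiction (sym eq) (chord-off-cycle k<n)
    edgeAt-injective {suc k} {suc l} k<n l<n eq = cong suc (cycleEdge-injective k<n l<n eq)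

    edgeAt-incident : ∀ k → Incident G (walk k) (edgeAt k)
    edgeAt-incident zero    = chord-incident
    edgeAt-incident (suc k) = joins-incidentʳ G (cycleEdge-joins k)

mainTheorem11 : (G : Graph) → Hamiltonian G → MaxDegreeAtLeast G 3 →
    MinCoprimeNumberAtMost G (size G ∸ 1) → TotalPrime G
mainTheorem11 G (3≤n , c , c-injective , c-step , c-close) (w , 3≤degree-w)
              (k , k≤m∸1 , _ , f , f-injective , f-range , f-coprime)
  with s , refl ← injective⇒surjective c c-injective w
  = CoverLabelling.totalPrime G cover f-injective (proj₁ ∘ f-range) f<m f-coprime
  where
  open HamiltonianWalk G 3≤n c-injective c-step c-close s

  cover : ConsecutiveEdgeCover G
  cover = consecutiveEdgeCover (subst (λ v → 3 ≤ degree G v) (sym walk-start) 3≤degree-w)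

  f<m : ∀ v → f v < size G
  f<m v = m≤n∸1⇒m<n (proj₁ (f-range v)) (≤-trans (proj₂ (f-range v)) k≤m∸1)
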